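{- Let $k\geq 3$ be an integer. Then there exists a zero-sum half-set of $\mathbb{Z}_{2k+1}$ admitting a simple ordering.
   Context: A half-set of $\mathbb{Z}_{2k+1}$ is a subset $V$ of size $k$ with $V\cup(-V)=\mathbb{Z}_{2k+1}\setminus\{0\}$. It is zero-sum if its elements sum to $0$ in $\mathbb{Z}_{2k+1}$. An ordering $(b_0,\dots,b_{k-1})$ of its elements is simple if the partial sums $c_i=\sum_{j=0}^{i}b_j$, $0\le i\le k-1$, are pairwise distinct in $\mathbb{Z}_{2k+1}$. -}

module Defs where

open import Data.Nat using (ℕ; zero; suc; _+_; _*_; _%_; _<_)
open import Data.Nat.DivMod using (m%n<n)
open import Data.Fin using (Fin; toℕ; fromℕ<)
open import Data.List using (List; []; _∷_; length; foldr; map; sum)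
open import Data.List.Membership.Propositional using (_∈_)
open import Data.List.Relation.Unary.Unique.Propositional using (Unique)
open import Data.List.Relation.Binary.Permutation.Propositional using (_↭_)
open import Data.Product using (_×_)
open import Data.Sum using (_⊎_)
open import Relation.Binary.PropositionalEquality using (_≡_; _≢_)

Zodd : ℕ → Set
Zodd k = Fin (suc (2 * k))

red : {k : ℕ} → ℕ → Zodd k
red {k} m = fromℕ< (m%n<n m (suc (2 * k)))

0ₖ : {k : ℕ} → Zodd k
0ₖ {k} = red {k} 0

_+ₖ_ : {k : ℕ} → Zodd k → Zodd k → Zodd k
_+ₖ_ {k} a b = red {k} (toℕ a + toℕ b)

negₖ : {k : ℕ} → Zodd k → Zodd k
negₖ {k} a = red {k} ((2 * k) * toℕ a)

sumₖ : {k : ℕ} → List (Zodd k) → Zodd k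
sumₖ {k} = foldr (_+ₖ_ {k}) (0ₖ {k})

-- A finite subset V of Z_{2k+1} is given by a duplicate-free list of its
-- elements.  V is a half-set if |V| = k and V ∪ (-V) = Z_{2k+1} \ {0}.
IsHalfSet : (k : ℕ) → List (Zodd k) → Set
IsHalfSet k V =
  Unique V × length V ≡ k
  × (∀ (x : Zodd k) → x ≢ 0ₖ {k} → (x ∈ V ⊎ negₖ {k} x ∈ V))
  × (∀ (x : Zodd k) → x ∈ V → x ≢ 0ₖ {k})
  -- (x ∈ V ⇒ x ≠ 0; then -x ∈ -V also avoids 0, so V ∪ (-V) ⊆ Z∖{0})

IsZeroSum : (k : ℕ) → List (Zodd k) → Set
IsZeroSum k V = sumₖ {k} V ≡ 0ₖ {k}

partialSumsFrom : {k : ℕ} → Zodd k → List (Zodd k) → List (Zodd k)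
partialSumsFrom acc [] = []
partialSumsFrom {k} acc (b ∷ bs) =
  let c = _+ₖ_ {k} acc b in c ∷ partialSumsFrom {k} c bs

partialSums : {k : ℕ} → List (Zodd k) → List (Zodd k)
partialSums {k} = partialSumsFrom {k} (0ₖ {k})

IsSimpleOrderingOf : (k : ℕ) → List (Zodd k) → List (Zodd k) → Set
IsSimpleOrderingOf k V bs = (bs ↭ V) × Unique (partialSums {k} bs)

module Submission where

-- Read an ordering (b₁, …, b_k) as a walk 0 = p₀, p₁, …, p_k in ℕ with bᵢ ≡ pᵢ − pᵢ₋₁ modulo
-- 2k + 1. If the step lengths ∣pᵢ − pᵢ₋₁∣ are 1, …, k in some order, the pᵢ are distinct modulo
-- 2k + 1 and p_k ≡ 0, then {b₁, …, b_k} contains exactly one of ±d for each d = 1, …, k, its sum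
-- telescopes to p_k ≡ 0, and the partial sums of (b₁, …, b_k) are the distinct pᵢ.
-- Such walks are written down for each residue of k modulo 4 (by parity of 1 + ⋯ + k they end at
-- 0 when k ≡ 0, 3 and at 2k + 1 when k ≡ 1, 2), joining single steps and zigzags
-- x, x + d, x − 1, x + d + 1, x − 2, …, whose step lengths d, d + 1, d + 2, … are consecutive.
-- The points are distinct modulo 2k + 1 because, sorted, they increase inside a window of
-- length 2k + 1.

open import Defs
open import Data.Nat
open import Data.Nat.Properties
open import Data.Nat.DivMod using (m≡m%n+[m/n]*n; m<n⇒m%n≡m; [m+kn]%n≡m%n; %-distribˡ-+; n%n≡0)
open import Data.Nat.Tactic.RingSolver using (solve; solve-∀)
open import Data.Fin using (toℕ)
open import Data.Fin.Properties using (toℕ-fromℕ<; toℕ-injective; toℕ<n)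
open import Data.List using (List; []; _∷_; _++_; [_]; map; length)
open import Data.List.Properties using (++-identityʳ; length-map; map-∘; map-cong)
open import Data.List.Membership.Propositional using (_∈_)
open import Data.List.Membership.Propositional.Properties using (∈-map⁻)
open import Data.List.Relation.Unary.Any using (here; there)
open import Data.List.Relation.Unary.All as All using (All)
import Data.List.Relation.Unary.All.Properties as All
import Data.List.Relation.Unary.AllPairs as AllPairs
open import Data.List.Relation.Unary.Unique.Propositional using (Unique)
import Data.List.Relation.Unary.Unique.Propositional.Properties as Unique
open import Data.List.Relation.Binary.Permutation.Propositional
  using (_↭_; ↭-refl; ↭-sym; ↭-trans; ↭-reflexive; prep; ↭⇒↭ₛ; module PermutationReasoning)
open import Data.List.Relation.Binary.Permutation.Propositional.Properties
  using (++-commutativeMonoid; ++⁺; map⁺; All-resp-↭; Any-resp-↭; ↭-length)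
import Algebra.Solver.CommutativeMonoid (++-commutativeMonoid {A = ℕ}) as ++-↭
open import Data.Product using (Σ; _×_; _,_; proj₁)
open import Data.Sum using (_⊎_; inj₁; inj₂)
open import Function using (_∘_)
open import Relation.Nullary using (yes; no; contradiction)
open import Relation.Binary.Structures using (IsPreorder)
open import Relation.Binary.PropositionalEquality hiding ([_])
open import Relation.Binary.PropositionalEquality.Properties using () renaming (isPreorder to ≡-isPreorder)
open import Data.List.Relation.Binary.Permutation.Setoid.Properties (setoid ℕ) using (Unique-resp-↭)

n*[1+m]%[1+n]≡n∸m : ∀ {m n} → m ≤ n → n * suc m % suc n ≡ n ∸ m
n*[1+m]%[1+n]≡n∸m {m} {n} m≤n = begin
  n * suc m % suc n             ≡⟨ cong (λ x → x * suc m % suc n) (m∸n+n≡m m≤n) ⟨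
  (e + m) * suc m % suc n       ≡⟨ cong (_% suc n) (expand e m) ⟩
  (e + m * suc (e + m)) % suc n ≡⟨ cong (λ x → (e + m * suc x) % suc n) (m∸n+n≡m m≤n) ⟩
  (e + m * suc n) % suc n       ≡⟨ [m+kn]%n≡m%n e m (suc n) ⟩
  e % suc n                     ≡⟨ m<n⇒m%n≡m (s≤s (m∸n≤m n m)) ⟩
  e                             ∎
  where
  open ≡-Reasoning
  e = n ∸ m
  expand : ∀ e m → (e + m) * suc m ≡ e + m * suc (e + m)
  expand = solve-∀

-- Writing m and n as r + q * o with the same remainder r, a larger quotient costs a whole o.
m<n<m+o⇒m%o≢n%o : ∀ {m n o} .{{_ : NonZero o}} → m < n → n < m + o → m % o ≢ n % o
m<n<m+o⇒m%o≢n%o {m} {n} {o} m<n n<m+o m%o≡n%o = <-irrefl refl (<-≤-trans n<m+o m+o≤n)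
  where
  open ≤-Reasoning
  r = n % o
  m≡ : m ≡ r + m / o * o
  m≡ = trans (m≡m%n+[m/n]*n m o) (cong (_+ m / o * o) m%o≡n%o)
  n≡ : n ≡ r + n / o * o
  n≡ = m≡m%n+[m/n]*n n o
  m/o<n/o : m / o < n / o
  m/o<n/o = ≰⇒> λ n/o≤m/o → <⇒≱ m<n (begin
    n               ≡⟨ n≡ ⟩
    r + n / o * o   ≤⟨ +-monoʳ-≤ r (*-monoˡ-≤ o n/o≤m/o) ⟩
    r + m / o * o   ≡⟨ m≡ ⟨
    m               ∎)
  m+o≤n : m + o ≤ n
  m+o≤n = begin
    m + o                 ≡⟨ cong (_+ o) m≡ ⟩
    r + m / o * o + o     ≡⟨ +-assoc r _ o ⟩
    r + (m / o * o + o)   ≡⟨ cong (r +_) (+-comm _ o) ⟩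
    r + suc (m / o) * o   ≤⟨ +-monoʳ-≤ r (*-monoˡ-≤ o m/o<n/o) ⟩
    r + n / o * o         ≡⟨ n≡ ⟨
    n                     ∎

m+o≡n⇒m≤n : ∀ {m n} o → m + o ≡ n → m ≤ n
m+o≡n⇒m≤n {m} o refl = m≤m+n m o

range : ℕ → ℕ → List ℕ
range a zero    = []
range a (suc n) = a ∷ range (suc a) n

length-range : ∀ a n → length (range a n) ≡ n
length-range a zero    = refl
length-range a (suc n) = cong suc (length-range (suc a) n)

range-++ : ∀ a i j → range a i ++ range (a + i) j ≡ range a (i + j)
range-++ a zero    j = cong (λ b → range b j) (+-identityʳ a)
range-++ a (suc i) j = cong (a ∷_) (begin
  range (suc a) i ++ range (a + suc i) j ≡⟨ cong (λ b → range (suc a) i ++ range b j) (+-suc a i) ⟩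
  range (suc a) i ++ range (suc a + i) j ≡⟨ range-++ (suc a) i j ⟩
  range (suc a) (i + j)                  ∎)
  where open ≡-Reasoning

infixr 5 _≺∷_
data Chain (R : ℕ → ℕ → Set) (lo hi : ℕ) : List ℕ → Set where
  end  : R lo hi → Chain R lo hi []
  _≺∷_ : ∀ {x xs} → R lo x → Chain R (suc x) hi xs → Chain R lo hi (x ∷ xs)

-- strictly increasing, with entries in [lo, hi)
Ascending : ℕ → ℕ → List ℕ → Set
Ascending = Chain _≤_

-- exactly lo, lo + 1, …, hi − 1
Consecutive : ℕ → ℕ → List ℕ → Set
Consecutive = Chain _≡_

module _ {R : ℕ → ℕ → Set} (R-isPreorder : IsPreorder _≡_ R) where
  open IsPreorder R-isPreorder using (reflexive) renaming (trans to ≺-trans)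

  chain-weaken : ∀ {lo lo′ hi xs} → R lo lo′ → Chain R lo′ hi xs → Chain R lo hi xs
  chain-weaken lo≺lo′ (end lo′≺hi)   = end (≺-trans lo≺lo′ lo′≺hi)
  chain-weaken lo≺lo′ (lo′≺x ≺∷ xs) = ≺-trans lo≺lo′ lo′≺x ≺∷ xs

  chain-range-++ : ∀ {lo hi} a n {ys} → R lo a → Chain R (a + n) hi ys → Chain R lo hi (range a n ++ ys)
  chain-range-++ a zero    lo≺a ys = chain-weaken (≺-trans lo≺a (reflexive (sym (+-identityʳ a)))) ys
  chain-range-++ {hi = hi} a (suc n) {ys} lo≺a c =
    lo≺a ≺∷ chain-range-++ (suc a) n (reflexive refl) (subst (λ b → Chain R b hi ys) (+-suc a n) c)

  chain-range : ∀ {lo hi} a n → R lo a → R (a + n) hi → Chain R lo hi (range a n)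
  chain-range {lo} {hi} a n lo≺a a+n≺hi =
    subst (Chain R lo hi) (++-identityʳ (range a n)) (chain-range-++ a n lo≺a (end a+n≺hi))

ascending-range-++ : ∀ {lo hi} a n {ys} → lo ≤ a → Ascending (a + n) hi ys →
                     Ascending lo hi (range a n ++ ys)
ascending-range-++ = chain-range-++ ≤-isPreorder

ascending-range : ∀ {lo hi} a n → lo ≤ a → a + n ≤ hi → Ascending lo hi (range a n)
ascending-range = chain-range ≤-isPreorder

consecutive-range-++ : ∀ {lo hi} a n {ys} → lo ≡ a → Consecutive (a + n) hi ys →
                       Consecutive lo hi (range a n ++ ys)
consecutive-range-++ = chain-range-++ ≡-isPreorder

consecutive-range : ∀ {lo hi} a n → lo ≡ a → a + n ≡ hi → Consecutive lo hi (range a n)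
consecutive-range = chain-range ≡-isPreorder

consecutive-shape : ∀ {lo hi xs} → Consecutive lo hi xs → lo + length xs ≡ hi × xs ≡ range lo (length xs)
consecutive-shape {lo} (end refl)  = +-identityʳ lo , refl
consecutive-shape {lo} (refl ≺∷ c) =
  let (len≡ , xs≡) = consecutive-shape c in trans (+-suc lo _) len≡ , cong (lo ∷_) xs≡

consecutive⇒range : ∀ {lo n xs} → Consecutive lo (lo + n) xs → xs ≡ range lo n
consecutive⇒range {lo} c =
  let (len≡ , xs≡) = consecutive-shape c in trans xs≡ (cong (range lo) (+-cancelˡ-≡ lo _ _ len≡))

↭-consecutive⇒↭range : ∀ lo n {xs ys} → xs ↭ ys → Consecutive lo (lo + n) ys → xs ↭ range lo n
↭-consecutive⇒↭range _ _ xs↭ys c = ↭-trans xs↭ys (↭-reflexive (consecutive⇒range c))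

ascending-lo≤hi : ∀ {lo hi xs} → Ascending lo hi xs → lo ≤ hi
ascending-lo≤hi (end lo≤hi)   = lo≤hi
ascending-lo≤hi (lo≤x ≺∷ asc) = ≤-trans lo≤x (<⇒≤ (ascending-lo≤hi asc))

ascending-bounds : ∀ {lo hi xs} → Ascending lo hi xs → All (λ x → lo ≤ x × x < hi) xs
ascending-bounds (end _)       = All.[]
ascending-bounds (lo≤x ≺∷ asc) = (lo≤x , ascending-lo≤hi asc) All.∷
  All.map (λ (x<y , y<hi) → ≤-trans lo≤x (<⇒≤ x<y) , y<hi) (ascending-bounds asc)

ascending⇒unique : ∀ {lo hi xs} → Ascending lo hi xs → Unique xs
ascending⇒unique (end _)    = AllPairs.[]
ascending⇒unique (_ ≺∷ asc) =
  All.map (λ (x<y , _) → <⇒≢ x<y) (ascending-bounds asc) AllPairs.∷ ascending⇒unique asc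

ascending-residues-unique : ∀ {lo hi xs} o .{{_ : NonZero o}} →
                            Ascending lo hi xs → hi ≤ lo + o → Unique (map (_% o) xs)
ascending-residues-unique o (end _)         _        = AllPairs.[]
ascending-residues-unique o (lo≤x ≺∷ asc) hi≤lo+o =
  All.map⁺ (All.map (λ (x<y , y<hi) → m<n<m+o⇒m%o≢n%o x<y (≤-trans y<hi hi≤x+o)) (ascending-bounds asc))
  AllPairs.∷ ascending-residues-unique o asc (≤-trans hi≤x+o (n≤1+n _))
  where
  hi≤x+o = ≤-trans hi≤lo+o (+-monoˡ-≤ o lo≤x)

∈-range : ∀ {a n c} → a ≤ c → c < a + n → c ∈ range a n
∈-range {a} {zero}  a≤c c<a+0 = contradiction (≤-trans (≤-reflexive (+-identityʳ a)) a≤c) (<⇒≱ c<a+0)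
∈-range {a} {suc n} {c} a≤c c<a+n with a ≟ c
... | yes refl = here refl
... | no a≢c   = there (∈-range (≤∧≢⇒< a≤c a≢c) (subst (c <_) (+-suc a n) c<a+n))

stepLengths : ℕ → List ℕ → List ℕ
stepLengths x []       = []
stepLengths x (y ∷ ys) = ∣ x - y ∣ ∷ stepLengths y ys

endpoint : ℕ → List ℕ → ℕ
endpoint x []       = x
endpoint x (y ∷ ys) = endpoint y ys

stepLengths-++ : ∀ x ys zs → stepLengths x (ys ++ zs) ≡ stepLengths x ys ++ stepLengths (endpoint x ys) zs
stepLengths-++ x []       zs = refl
stepLengths-++ x (y ∷ ys) zs = cong (∣ x - y ∣ ∷_) (stepLengths-++ y ys zs)

endpoint-++ : ∀ x ys zs → endpoint x (ys ++ zs) ≡ endpoint (endpoint x ys) zs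
endpoint-++ x []       zs = refl
endpoint-++ x (y ∷ ys) zs = endpoint-++ y ys zs

record Walk (x y : ℕ) (lengths visited : List ℕ) : Set where
  field
    points    : List ℕ
    endpoint≡ : endpoint x points ≡ y
    lengths↭  : stepLengths x points ↭ lengths
    points↭   : points ↭ visited

-- From a closed walk to a half-set with a simple ordering

module Cyclic (k : ℕ) where

  N : ℕ
  N = suc (2 * k)

  ⟦_⟧ : ℕ → Zodd k
  ⟦_⟧ = red {k}

  infixl 6 _⊕_
  _⊕_ : Zodd k → Zodd k → Zodd k
  _⊕_ = _+ₖ_ {k}

  ⊖_ : Zodd k → Zodd k
  ⊖_ = negₖ {k}

  toℕ-⟦⟧ : ∀ n → toℕ ⟦ n ⟧ ≡ n % N
  toℕ-⟦⟧ n = toℕ-fromℕ< _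

  toℕ-⟦⟧-< : ∀ {n} → n < N → toℕ ⟦ n ⟧ ≡ n
  toℕ-⟦⟧-< {n} n<N = trans (toℕ-⟦⟧ n) (m<n⇒m%n≡m n<N)

  ⟦⟧-cong : ∀ m n → m % N ≡ n % N → ⟦ m ⟧ ≡ ⟦ n ⟧
  ⟦⟧-cong m n eq = toℕ-injective (trans (toℕ-⟦⟧ m) (trans eq (sym (toℕ-⟦⟧ n))))

  ⟦toℕ⟧ : ∀ x → ⟦ toℕ x ⟧ ≡ x
  ⟦toℕ⟧ x = toℕ-injective (toℕ-⟦⟧-< (toℕ<n x))

  ⟦⟧-+ : ∀ m n → ⟦ m ⟧ ⊕ ⟦ n ⟧ ≡ ⟦ m + n ⟧
  ⟦⟧-+ m n = ⟦⟧-cong (toℕ ⟦ m ⟧ + toℕ ⟦ n ⟧) (m + n) (begin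
    (toℕ ⟦ m ⟧ + toℕ ⟦ n ⟧) % N ≡⟨ cong₂ (λ a b → (a + b) % N) (toℕ-⟦⟧ m) (toℕ-⟦⟧ n) ⟩
    (m % N + n % N) % N        ≡⟨ %-distribˡ-+ m n N ⟨
    (m + n) % N                ∎)
    where open ≡-Reasoning

  ⊕-identityˡ : ∀ x → ⟦ 0 ⟧ ⊕ x ≡ x
  ⊕-identityˡ = ⟦toℕ⟧

  ⊕-assoc : ∀ x y z → (x ⊕ y) ⊕ z ≡ x ⊕ (y ⊕ z)
  ⊕-assoc x y z = begin
    (x ⊕ y) ⊕ z                       ≡⟨ cong ((x ⊕ y) ⊕_) (⟦toℕ⟧ z) ⟨
    ⟦ toℕ x + toℕ y ⟧ ⊕ ⟦ toℕ z ⟧     ≡⟨ ⟦⟧-+ (toℕ x + toℕ y) (toℕ z) ⟩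
    ⟦ toℕ x + toℕ y + toℕ z ⟧         ≡⟨ cong ⟦_⟧ (+-assoc (toℕ x) _ _) ⟩
    ⟦ toℕ x + (toℕ y + toℕ z) ⟧       ≡⟨ ⟦⟧-+ (toℕ x) (toℕ y + toℕ z) ⟨
    ⟦ toℕ x ⟧ ⊕ (y ⊕ z)               ≡⟨ cong (_⊕ (y ⊕ z)) (⟦toℕ⟧ x) ⟩
    x ⊕ (y ⊕ z)                       ∎
    where open ≡-Reasoning

  -- q − p, as 2k ≡ −1
  step : ℕ → ℕ → Zodd k
  step p q = ⟦ q + 2 * k * p ⟧

  ⟦m+jN⟧≡⟦m⟧ : ∀ m j → ⟦ m + j * N ⟧ ≡ ⟦ m ⟧
  ⟦m+jN⟧≡⟦m⟧ m j = ⟦⟧-cong (m + j * N) m ([m+kn]%n≡m%n m j N)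

  ⟦⟧-⊕-step : ∀ p q → ⟦ p ⟧ ⊕ step p q ≡ ⟦ q ⟧
  ⟦⟧-⊕-step p q = begin
    ⟦ p ⟧ ⊕ ⟦ q + 2 * k * p ⟧  ≡⟨ ⟦⟧-+ p (q + 2 * k * p) ⟩
    ⟦ p + (q + 2 * k * p) ⟧    ≡⟨ cong ⟦_⟧ rearrange ⟩
    ⟦ q + p * N ⟧              ≡⟨ ⟦m+jN⟧≡⟦m⟧ q p ⟩
    ⟦ q ⟧                      ∎
    where
    open ≡-Reasoning
    rearrange : p + (q + 2 * k * p) ≡ q + p * suc (2 * k)
    rearrange = solve (p ∷ q ∷ k ∷ [])

  step-up : ∀ p d → step p (p + d) ≡ ⟦ d ⟧
  step-up p d = trans (cong ⟦_⟧ rearrange) (⟦m+jN⟧≡⟦m⟧ d p)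
    where
    rearrange : p + d + 2 * k * p ≡ d + p * suc (2 * k)
    rearrange = solve (p ∷ d ∷ k ∷ [])

  step-down : ∀ q d → d < N → step (q + d) q ≡ ⊖ ⟦ d ⟧
  step-down q d d<N = begin
    ⟦ q + 2 * k * (q + d) ⟧  ≡⟨ cong ⟦_⟧ rearrange ⟩
    ⟦ 2 * k * d + q * N ⟧    ≡⟨ ⟦m+jN⟧≡⟦m⟧ (2 * k * d) q ⟩
    ⟦ 2 * k * d ⟧            ≡⟨ cong (λ x → ⟦ 2 * k * x ⟧) (toℕ-⟦⟧-< d<N) ⟨
    ⊖ ⟦ d ⟧                  ∎
    where
    open ≡-Reasoning
    rearrange : q + 2 * k * (q + d) ≡ 2 * k * d + q * suc (2 * k)
    rearrange = solve (q ∷ d ∷ k ∷ [])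

  k<N : k < N
  k<N = s≤s (m≤m+n k (k + 0))

  toℕ-⊖ : ∀ {x} → x ≢ ⟦ 0 ⟧ → toℕ (⊖ x) ≡ N ∸ toℕ x
  toℕ-⊖ {x} x≢0 with toℕ x in t≡ | toℕ<n x
  ... | zero  | _     = contradiction (toℕ-injective t≡) x≢0
  ... | suc s | 1+s<N = trans (toℕ-⟦⟧ (2 * k * suc s)) (n*[1+m]%[1+n]≡n∸m (<⇒≤ (s≤s⁻¹ 1+s<N)))

  ⊖-≢0 : ∀ {x} → x ≢ ⟦ 0 ⟧ → ⊖ x ≢ ⟦ 0 ⟧
  ⊖-≢0 {x} x≢0 ⊖x≡0 = <⇒≱ (toℕ<n x) (m∸n≡0⇒m≤n (trans (sym (toℕ-⊖ x≢0)) (cong toℕ ⊖x≡0)))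

  ⊖-involutive : ∀ {x} → x ≢ ⟦ 0 ⟧ → ⊖ ⊖ x ≡ x
  ⊖-involutive {x} x≢0 = toℕ-injective (begin
    toℕ (⊖ ⊖ x)          ≡⟨ toℕ-⊖ (⊖-≢0 x≢0) ⟩
    N ∸ toℕ (⊖ x)        ≡⟨ cong (N ∸_) (toℕ-⊖ x≢0) ⟩
    N ∸ (N ∸ toℕ x)      ≡⟨ m∸[m∸n]≡n (<⇒≤ (toℕ<n x)) ⟩
    toℕ x                ∎)
    where open ≡-Reasoning

  ‖_‖ : Zodd k → ℕ
  ‖ x ‖ = toℕ x ⊓ (N ∸ toℕ x)

  ‖x‖≢0⇒x≢0 : ∀ {x} → ‖ x ‖ ≢ 0 → x ≢ ⟦ 0 ⟧
  ‖x‖≢0⇒x≢0 ‖x‖≢0 refl = ‖x‖≢0 refl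

  ‖⟦d⟧‖ : ∀ {d} → d ≤ k → ‖ ⟦ d ⟧ ‖ ≡ d
  ‖⟦d⟧‖ {d} d≤k = begin
    toℕ ⟦ d ⟧ ⊓ (N ∸ toℕ ⟦ d ⟧)  ≡⟨ cong (λ t → t ⊓ (N ∸ t)) (toℕ-⟦⟧-< (≤-<-trans d≤k k<N)) ⟩
    d ⊓ (N ∸ d)                  ≡⟨ m≤n⇒m⊓n≡m (m+n≤o⇒m≤o∸n d d+d≤N) ⟩
    d                            ∎
    where
    open ≡-Reasoning
    d+d≤N : d + d ≤ N
    d+d≤N = ≤-trans (+-mono-≤ d≤k d≤k) (≤-trans (≤-reflexive (cong (k +_) (sym (+-identityʳ k)))) (n≤1+n _))

  ‖⊖x‖ : ∀ {x} → x ≢ ⟦ 0 ⟧ → ‖ ⊖ x ‖ ≡ ‖ x ‖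
  ‖⊖x‖ {x} x≢0 = begin
    toℕ (⊖ x) ⊓ (N ∸ toℕ (⊖ x))  ≡⟨ cong (λ t → t ⊓ (N ∸ t)) (toℕ-⊖ x≢0) ⟩
    (N ∸ t) ⊓ (N ∸ (N ∸ t))      ≡⟨ cong ((N ∸ t) ⊓_) (m∸[m∸n]≡n (<⇒≤ (toℕ<n x))) ⟩
    (N ∸ t) ⊓ t                  ≡⟨ ⊓-comm (N ∸ t) t ⟩
    t ⊓ (N ∸ t)                  ∎
    where
    open ≡-Reasoning
    t = toℕ x

  ‖x‖-bounds : ∀ {x} → x ≢ ⟦ 0 ⟧ → 1 ≤ ‖ x ‖ × ‖ x ‖ ≤ k
  ‖x‖-bounds {x} x≢0 = ⊓-glb 1≤t (m<n⇒0<n∸m (toℕ<n x)) , ‖x‖≤k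
    where
    t = toℕ x
    1≤t : 1 ≤ t
    1≤t = n≢0⇒n>0 (λ t≡0 → x≢0 (toℕ-injective t≡0))
    ‖x‖≤k : ‖ x ‖ ≤ k
    ‖x‖≤k with t ≤? k
    ... | yes t≤k = ≤-trans (m⊓n≤m t (N ∸ t)) t≤k
    ... | no  t≰k = ≤-trans (m⊓n≤n t (N ∸ t)) (≤-trans (∸-monoʳ-≤ N (≰⇒> t≰k)) (≤-reflexive N∸[1+k]≡k))
      where
      N∸[1+k]≡k : N ∸ suc k ≡ k
      N∸[1+k]≡k = trans (m+n∸m≡n k (k + 0)) (+-identityʳ k)

  x≡±⟦‖x‖⟧ : ∀ {x} → x ≢ ⟦ 0 ⟧ → x ≡ ⟦ ‖ x ‖ ⟧ ⊎ ⊖ x ≡ ⟦ ‖ x ‖ ⟧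
  x≡±⟦‖x‖⟧ {x} x≢0 with ⊓-sel (toℕ x) (N ∸ toℕ x)
  ... | inj₁ ‖x‖≡t   = inj₁ (trans (sym (⟦toℕ⟧ x)) (cong ⟦_⟧ (sym ‖x‖≡t)))
  ... | inj₂ ‖x‖≡N∸t = inj₂ (trans (sym (⟦toℕ⟧ (⊖ x))) (cong ⟦_⟧ (trans (toℕ-⊖ x≢0) (sym ‖x‖≡N∸t))))

  ‖‖-fibre : ∀ {x y} → x ≢ ⟦ 0 ⟧ → y ≢ ⟦ 0 ⟧ → ‖ x ‖ ≡ ‖ y ‖ → y ≡ x ⊎ y ≡ ⊖ x
  ‖‖-fibre {x} {y} x≢0 y≢0 ‖x‖≡‖y‖
    with x≡±⟦‖x‖⟧ x≢0 | subst (λ d → y ≡ ⟦ d ⟧ ⊎ ⊖ y ≡ ⟦ d ⟧) (sym ‖x‖≡‖y‖) (x≡±⟦‖x‖⟧ y≢0)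
  ... | inj₁ x≡a  | inj₁ y≡a  = inj₁ (trans y≡a (sym x≡a))
  ... | inj₁ x≡a  | inj₂ ⊖y≡a = inj₂ (trans (sym (⊖-involutive y≢0)) (cong ⊖_ (trans ⊖y≡a (sym x≡a))))
  ... | inj₂ ⊖x≡a | inj₁ y≡a  = inj₂ (trans y≡a (sym ⊖x≡a))
  ... | inj₂ ⊖x≡a | inj₂ ⊖y≡a =
    inj₁ (trans (sym (⊖-involutive y≢0)) (trans (cong ⊖_ (trans ⊖y≡a (sym ⊖x≡a))) (⊖-involutive x≢0)))

  ‖step‖ : ∀ p q → 1 ≤ ∣ p - q ∣ → ∣ p - q ∣ ≤ k → ‖ step p q ‖ ≡ ∣ p - q ∣
  ‖step‖ p q 1≤d d≤k with ≤-total p q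
  ... | inj₁ p≤q = begin
    ‖ step p q ‖              ≡⟨ cong (‖_‖ ∘ step p) (m+[n∸m]≡n p≤q) ⟨
    ‖ step p (p + (q ∸ p)) ‖  ≡⟨ cong ‖_‖ (step-up p (q ∸ p)) ⟩
    ‖ ⟦ q ∸ p ⟧ ‖             ≡⟨ ‖⟦d⟧‖ (subst (_≤ k) d≡q∸p d≤k) ⟩
    q ∸ p                     ≡⟨ d≡q∸p ⟨
    ∣ p - q ∣                 ∎
    where
    open ≡-Reasoning
    d≡q∸p = m≤n⇒∣m-n∣≡n∸m p≤q
  ... | inj₂ q≤p = begin
    ‖ step p q ‖              ≡⟨ cong (λ p → ‖ step p q ‖) (m+[n∸m]≡n q≤p) ⟨
    ‖ step (q + (p ∸ q)) q ‖  ≡⟨ cong ‖_‖ (step-down q (p ∸ q) (≤-<-trans p∸q≤k k<N)) ⟩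
    ‖ ⊖ ⟦ p ∸ q ⟧ ‖           ≡⟨ ‖⊖x‖ (‖x‖≢0⇒x≢0 (subst (_≢ 0) (sym ‖⟦p∸q⟧‖≡p∸q) p∸q≢0)) ⟩
    ‖ ⟦ p ∸ q ⟧ ‖             ≡⟨ ‖⟦p∸q⟧‖≡p∸q ⟩
    p ∸ q                     ≡⟨ d≡p∸q ⟨
    ∣ p - q ∣                 ∎
    where
    open ≡-Reasoning
    d≡p∸q = m≤n⇒∣n-m∣≡n∸m q≤p
    p∸q≤k = subst (_≤ k) d≡p∸q d≤k
    p∸q≢0 = n>0⇒n≢0 (subst (1 ≤_) d≡p∸q 1≤d)
    ‖⟦p∸q⟧‖≡p∸q = ‖⟦d⟧‖ p∸q≤k

  steps : ℕ → List ℕ → List (Zodd k)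
  steps p []       = []
  steps p (q ∷ qs) = step p q ∷ steps q qs

  partialSums-steps : ∀ p qs → partialSumsFrom {k} ⟦ p ⟧ (steps p qs) ≡ map ⟦_⟧ qs
  partialSums-steps p []       = refl
  partialSums-steps p (q ∷ qs) rewrite ⟦⟧-⊕-step p q = cong (⟦ q ⟧ ∷_) (partialSums-steps q qs)

  ⟦⟧-⊕-sum-steps : ∀ p qs → ⟦ p ⟧ ⊕ sumₖ {k} (steps p qs) ≡ ⟦ endpoint p qs ⟧
  ⟦⟧-⊕-sum-steps p []       = trans (⟦⟧-+ p 0) (cong ⟦_⟧ (+-identityʳ p))
  ⟦⟧-⊕-sum-steps p (q ∷ qs) = begin
    ⟦ p ⟧ ⊕ (step p q ⊕ sumₖ {k} (steps q qs))  ≡⟨ ⊕-assoc ⟦ p ⟧ (step p q) _ ⟨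
    ⟦ p ⟧ ⊕ step p q ⊕ sumₖ {k} (steps q qs)    ≡⟨ cong (_⊕ sumₖ {k} (steps q qs)) (⟦⟧-⊕-step p q) ⟩
    ⟦ q ⟧ ⊕ sumₖ {k} (steps q qs)               ≡⟨ ⟦⟧-⊕-sum-steps q qs ⟩
    ⟦ endpoint q qs ⟧                           ∎
    where open ≡-Reasoning

  map-‖‖-steps : ∀ p qs → All (λ d → 1 ≤ d × d ≤ k) (stepLengths p qs) →
                 map ‖_‖ (steps p qs) ≡ stepLengths p qs
  map-‖‖-steps p []       _                          = refl
  map-‖‖-steps p (q ∷ qs) ((1≤d , d≤k) All.∷ bounds) =
    cong₂ _∷_ (‖step‖ p q 1≤d d≤k) (map-‖‖-steps q qs bounds)

  record ClosedWalk : Set where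
    field
      final             : ℕ
      visited           : List ℕ
      walk              : Walk 0 final (range 1 k) visited
      closes            : final % N ≡ 0
      residues-distinct : Unique (map (_% N) visited)

  module HalfSetOfWalk (w : ClosedWalk) where
    open ClosedWalk w
    open Walk walk renaming (lengths↭ to lengths)

    V : List (Zodd k)
    V = steps 0 points

    1…k-ascending : Ascending 1 (1 + k) (range 1 k)
    1…k-ascending = ascending-range 1 k ≤-refl ≤-refl

    length-bounds : All (λ d → 1 ≤ d × d ≤ k) (stepLengths 0 points)
    length-bounds = All-resp-↭ (↭-sym lengths)
      (All.map (λ (1≤d , d<1+k) → 1≤d , s≤s⁻¹ d<1+k) (ascending-bounds 1…k-ascending))

    ‖V‖ : map ‖_‖ V ≡ stepLengths 0 points
    ‖V‖ = map-‖‖-steps 0 points length-bounds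

    V-unique : Unique V
    V-unique = Unique.map⁻ (subst Unique (sym ‖V‖)
      (Unique-resp-↭ (↭⇒↭ₛ (↭-sym lengths)) (ascending⇒unique 1…k-ascending)))

    V-length : length V ≡ k
    V-length = begin
      length V                  ≡⟨ length-map ‖_‖ V ⟨
      length (map ‖_‖ V)        ≡⟨ cong length ‖V‖ ⟩
      length (stepLengths 0 points)   ≡⟨ ↭-length lengths ⟩
      length (range 1 k)        ≡⟨ length-range 1 k ⟩
      k                         ∎
      where open ≡-Reasoning

    V-nonzero : ∀ x → x ∈ V → x ≢ ⟦ 0 ⟧
    V-nonzero x x∈V = ‖x‖≢0⇒x≢0 (n>0⇒n≢0 (proj₁ (All.lookup ‖V‖-bounds x∈V)))
      where
      ‖V‖-bounds : All (λ x → 1 ≤ ‖ x ‖ × ‖ x ‖ ≤ k) V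
      ‖V‖-bounds = All.map⁻ (subst (All _) (sym ‖V‖) length-bounds)

    ‖x‖∈lengths : ∀ {x} → x ≢ ⟦ 0 ⟧ → ‖ x ‖ ∈ stepLengths 0 points
    ‖x‖∈lengths x≢0 = let (1≤‖x‖ , ‖x‖≤k) = ‖x‖-bounds x≢0 in
      Any-resp-↭ (↭-sym lengths) (∈-range 1≤‖x‖ (s≤s ‖x‖≤k))

    V-covers : ∀ x → x ≢ ⟦ 0 ⟧ → x ∈ V ⊎ ⊖ x ∈ V
    V-covers x x≢0 with ∈-map⁻ ‖_‖ (subst (‖ x ‖ ∈_) (sym ‖V‖) (‖x‖∈lengths x≢0))
    ... | y , y∈V , ‖x‖≡‖y‖ with ‖‖-fibre x≢0 (V-nonzero y y∈V) ‖x‖≡‖y‖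
    ...   | inj₁ refl = inj₁ y∈V
    ...   | inj₂ refl = inj₂ y∈V

    V-zero-sum : sumₖ {k} V ≡ ⟦ 0 ⟧
    V-zero-sum = begin
      sumₖ {k} V              ≡⟨ ⊕-identityˡ (sumₖ {k} V) ⟨
      ⟦ 0 ⟧ ⊕ sumₖ {k} V      ≡⟨ ⟦⟧-⊕-sum-steps 0 points ⟩
      ⟦ endpoint 0 points ⟧   ≡⟨ ⟦⟧-cong (endpoint 0 points) 0 (trans (cong (_% N) endpoint≡) closes) ⟩
      ⟦ 0 ⟧                   ∎
      where open ≡-Reasoning

    V-partialSums-unique : Unique (partialSums {k} V)
    V-partialSums-unique = subst Unique (sym (partialSums-steps 0 points))
      (Unique.map⁻ (subst Unique (sym toℕ-partialSums)
        (Unique-resp-↭ (↭⇒↭ₛ (map⁺ (_% N) (↭-sym points↭))) residues-distinct)))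
      where
      toℕ-partialSums : map toℕ (map ⟦_⟧ points) ≡ map (_% N) points
      toℕ-partialSums = trans (sym (map-∘ points)) (map-cong toℕ-⟦⟧ points)

  halfSet-of-walk : ClosedWalk →
    Σ (List (Zodd k)) (λ V → IsHalfSet k V × IsZeroSum k V
      × Σ (List (Zodd k)) (λ bs → IsSimpleOrderingOf k V bs))
  halfSet-of-walk w =
    V , (V-unique , V-length , V-covers , V-nonzero) , V-zero-sum , V , ↭-refl , V-partialSums-unique
    where open HalfSetOfWalk w

-- Walks assembled from single steps and zigzags

open ++-↭ using (_⊜_; _⊕_)
open Walk

stepLengths-up : ∀ x d ys → stepLengths x (x + d ∷ ys) ≡ d ∷ stepLengths (x + d) ys
stepLengths-up x d ys = cong (_∷ stepLengths (x + d) ys) (∣m-m+n∣≡n x d)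

stepLengths-down : ∀ x d ys → stepLengths (d + x) (x ∷ ys) ≡ d ∷ stepLengths x ys
stepLengths-down x d ys =
  cong (_∷ stepLengths x ys) (trans (∣-∣-comm (d + x) x) (trans (cong ∣ x -_∣ (+-comm d x)) (∣m-m+n∣≡n x d)))

-- From lo + j: up by d, down by d + 1, up by d + 2, ..., down by d + 2j - 1, ending at lo.
zigzag : ℕ → ℕ → ℕ → List ℕ
zigzag lo d zero    = []
zigzag lo d (suc j) = lo + suc j + d ∷ lo + j ∷ zigzag lo (2 + d) j

endpoint-zigzag : ∀ lo d j → endpoint (lo + j) (zigzag lo d j) ≡ lo
endpoint-zigzag lo d zero    = +-identityʳ lo
endpoint-zigzag lo d (suc j) = endpoint-zigzag lo (2 + d) j

stepLengths-zigzag : ∀ lo d j → stepLengths (lo + j) (zigzag lo d j) ≡ range d (j + j)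
stepLengths-zigzag lo d zero    = refl
stepLengths-zigzag lo d (suc j) = begin
  stepLengths (lo + suc j) (lo + suc j + d ∷ lo + j ∷ zigzag lo (2 + d) j)
    ≡⟨ stepLengths-up (lo + suc j) d _ ⟩
  d ∷ stepLengths (lo + suc j + d) (lo + j ∷ zigzag lo (2 + d) j)
    ≡⟨ cong (λ x → d ∷ stepLengths x (lo + j ∷ zigzag lo (2 + d) j)) lo+[1+j]+d≡1+d+[lo+j] ⟩
  d ∷ stepLengths (suc d + (lo + j)) (lo + j ∷ zigzag lo (2 + d) j)
    ≡⟨ cong (d ∷_) (stepLengths-down (lo + j) (suc d) _) ⟩
  d ∷ suc d ∷ stepLengths (lo + j) (zigzag lo (2 + d) j)
    ≡⟨ cong (λ r → d ∷ suc d ∷ r) (stepLengths-zigzag lo (2 + d) j) ⟩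
  range d (2 + (j + j))
    ≡⟨ cong (range d ∘ suc) (+-suc j j) ⟨
  range d (suc j + suc j) ∎
  where
  open ≡-Reasoning
  lo+[1+j]+d≡1+d+[lo+j] : lo + suc j + d ≡ suc d + (lo + j)
  lo+[1+j]+d≡1+d+[lo+j] = solve (lo ∷ j ∷ d ∷ [])

zigzag-↭ : ∀ lo d j → zigzag lo d j ↭ range lo j ++ range (lo + j + d) j
zigzag-↭ lo d zero    = ↭-refl
zigzag-↭ lo d (suc j) = begin
  lo + suc j + d ∷ lo + j ∷ zigzag lo (2 + d) j
    ↭⟨ prep _ (prep _ (zigzag-↭ lo (2 + d) j)) ⟩
  lo + suc j + d ∷ lo + j ∷ range lo j ++ range (lo + j + (2 + d)) j
    ↭⟨ ++-↭.solve 4 (λ h l L H → h ⊕ (l ⊕ (L ⊕ H)) ⊜ (L ⊕ l) ⊕ (h ⊕ H)) ↭-refl [ _ ] [ _ ] (range lo j) _ ⟩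
  (range lo j ++ [ lo + j ]) ++ lo + suc j + d ∷ range (lo + j + (2 + d)) j
    ≡⟨ cong₂ (λ L b → L ++ lo + suc j + d ∷ range b j) (range-++ lo j 1) lo+j+[2+d]≡1+lo+[1+j]+d ⟩
  range lo (j + 1) ++ range (lo + suc j + d) (suc j)
    ≡⟨ cong (λ n → range lo n ++ range (lo + suc j + d) (suc j)) (+-comm j 1) ⟩
  range lo (suc j) ++ range (lo + suc j + d) (suc j) ∎
  where
  open PermutationReasoning
  lo+j+[2+d]≡1+lo+[1+j]+d : lo + j + (2 + d) ≡ suc (lo + suc j + d)
  lo+j+[2+d]≡1+lo+[1+j]+d = solve (lo ∷ j ∷ d ∷ [])

infixr 5 _▸_
_▸_ : ∀ {x y z ds es P Q} → Walk x y ds P → Walk y z es Q → Walk x z (ds ++ es) (P ++ Q)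
_▸_ {x} {es = es} v w = record
  { points    = points v ++ points w
  ; endpoint≡ = trans (endpoint-++ x (points v) (points w))
                      (subst (λ y → endpoint y (points w) ≡ _) (sym (endpoint≡ v)) (endpoint≡ w))
  ; lengths↭  = ↭-trans (↭-reflexive (stepLengths-++ x (points v) (points w)))
                        (++⁺ (lengths↭ v)
                             (subst (λ y → stepLengths y (points w) ↭ es) (sym (endpoint≡ v)) (lengths↭ w)))
  ; points↭   = ++⁺ (points↭ v) (points↭ w)
  }

up : ∀ x d → Walk x (x + d) [ d ] [ x + d ]
up x d = record
  { points    = [ x + d ]
  ; endpoint≡ = refl
  ; lengths↭  = ↭-reflexive (stepLengths-up x d [])
  ; points↭   = ↭-refl
  }

down : ∀ x d → Walk (d + x) x [ d ] [ x ]
down x d = record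
  { points    = [ x ]
  ; endpoint≡ = refl
  ; lengths↭  = ↭-reflexive (stepLengths-down x d [])
  ; points↭   = ↭-refl
  }

zigzag-walk : ∀ lo d j → Walk (lo + j) lo (range d (j + j)) (range lo j ++ range (lo + j + d) j)
zigzag-walk lo d j = record
  { points    = zigzag lo d j
  ; endpoint≡ = endpoint-zigzag lo d j
  ; lengths↭  = ↭-reflexive (stepLengths-zigzag lo d j)
  ; points↭   = zigzag-↭ lo d j
  }

relocate : ∀ {x x′ y ds P} → Walk x y ds P → x ≡ x′ → Walk x′ y ds P
relocate w refl = w

reshape : ∀ {x y ds ds′ P P′} → ds ↭ ds′ → P ↭ P′ → Walk x y ds P → Walk x y ds′ P′
reshape ds↭ds′ P↭P′ w = record
  { points    = points w
  ; endpoint≡ = endpoint≡ w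
  ; lengths↭  = ↭-trans (lengths↭ w) ds↭ds′
  ; points↭   = ↭-trans (points↭ w) P↭P′
  }

-- One closed walk for each residue of k modulo 4

-- In each walk, Rᵢ are the step lengths and Lᵢ, Hᵢ the low and high points of its i-th zigzag.
walk-4m+3 : ∀ m → Cyclic.ClosedWalk (3 + m * 4)
walk-4m+3 m = record
  { final             = 0
  ; visited           = _
  ; walk              = reshape lengths visited
                          (up 0 x ▸ zigzag-walk (suc m) 1 m ▸ zigzag-walk 0 (2 + m + m) (suc m))
  ; closes            = refl
  ; residues-distinct = ascending-residues-unique N ascending ≤-refl
  }
  where
  N  = suc (2 * (3 + m * 4))
  x  = suc m + m
  R₁ = range 1 (m + m)
  R₂ = range (2 + m + m) (suc m + suc m)
  L₁ = range (suc m) m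
  H₁ = range (suc m + m + 1) m
  L₂ = range 0 (suc m)
  H₂ = range (suc m + (2 + m + m)) (suc m)

  lengths : x ∷ R₁ ++ R₂ ↭ range 1 (3 + m * 4)
  lengths = ↭-consecutive⇒↭range 1 (3 + m * 4)
    (++-↭.solve 3 (λ x R₁ R₂ → x ⊕ (R₁ ⊕ R₂) ⊜ R₁ ⊕ (x ⊕ R₂)) ↭-refl [ x ] R₁ R₂)
    (consecutive-range-++ 1 (m + m) refl (refl ≺∷ consecutive-range (2 + m + m) (suc m + suc m) refl R₂-end))
    where
    R₂-end : 2 + m + m + (suc m + suc m) ≡ 1 + (3 + m * 4)
    R₂-end = solve (m ∷ [])

  visited : x ∷ (L₁ ++ H₁) ++ (L₂ ++ H₂) ↭ L₂ ++ L₁ ++ x ∷ H₁ ++ H₂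
  visited = ++-↭.solve 5 (λ x L₁ H₁ L₂ H₂ → x ⊕ ((L₁ ⊕ H₁) ⊕ (L₂ ⊕ H₂)) ⊜ L₂ ⊕ (L₁ ⊕ (x ⊕ (H₁ ⊕ H₂))))
              ↭-refl [ x ] L₁ H₁ L₂ H₂

  ascending : Ascending 0 N (L₂ ++ L₁ ++ x ∷ H₁ ++ H₂)
  ascending =
    ascending-range-++ 0 (suc m) z≤n (ascending-range-++ (suc m) m ≤-refl (≤-refl ≺∷
    ascending-range-++ (suc m + m + 1) m H₁-start
    (ascending-range (suc m + (2 + m + m)) (suc m) H₂-start H₂-end)))
    where
    H₁-start : suc (suc m + m) ≤ suc m + m + 1
    H₁-start = m+o≡n⇒m≤n 0 (solve (m ∷ []))
    H₂-start : suc m + m + 1 + m ≤ suc m + (2 + m + m)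
    H₂-start = m+o≡n⇒m≤n 1 (solve (m ∷ []))
    H₂-end : suc m + (2 + m + m) + suc m ≤ suc (2 * (3 + m * 4))
    H₂-end = m+o≡n⇒m≤n (3 + m * 4) (solve (m ∷ []))

walk-4m+4 : ∀ m → Cyclic.ClosedWalk (4 + m * 4)
walk-4m+4 m = record
  { final             = 0
  ; visited           = _
  ; walk              = reshape lengths visited
                          (up 0 x ▸ zigzag-walk (2 + m) 2 m ▸ zigzag-walk 1 (3 + m + m) (suc m) ▸ down 0 1)
  ; closes            = refl
  ; residues-distinct = ascending-residues-unique N ascending ≤-refl
  }
  where
  N  = suc (2 * (4 + m * 4))
  x  = 2 + m + m
  R₁ = range 2 (m + m)
  R₂ = range (3 + m + m) (suc m + suc m)
  L₁ = range (2 + m) m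
  H₁ = range (2 + m + m + 2) m
  L₂ = range 1 (suc m)
  H₂ = range (1 + suc m + (3 + m + m)) (suc m)

  lengths : x ∷ R₁ ++ R₂ ++ [ 1 ] ↭ range 1 (4 + m * 4)
  lengths = ↭-consecutive⇒↭range 1 (4 + m * 4)
    (++-↭.solve 4 (λ x R₁ R₂ o → x ⊕ (R₁ ⊕ (R₂ ⊕ o)) ⊜ o ⊕ (R₁ ⊕ (x ⊕ R₂))) ↭-refl [ x ] R₁ R₂ [ 1 ])
    (refl ≺∷ consecutive-range-++ 2 (m + m) refl
      (refl ≺∷ consecutive-range (3 + m + m) (suc m + suc m) refl R₂-end))
    where
    R₂-end : 3 + m + m + (suc m + suc m) ≡ 1 + (4 + m * 4)
    R₂-end = solve (m ∷ [])

  visited : x ∷ (L₁ ++ H₁) ++ (L₂ ++ H₂) ++ [ 0 ] ↭ 0 ∷ L₂ ++ L₁ ++ x ∷ H₁ ++ H₂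
  visited = ++-↭.solve 6 (λ x L₁ H₁ L₂ H₂ o → x ⊕ ((L₁ ⊕ H₁) ⊕ ((L₂ ⊕ H₂) ⊕ o))
                                            ⊜ o ⊕ (L₂ ⊕ (L₁ ⊕ (x ⊕ (H₁ ⊕ H₂)))))
              ↭-refl [ x ] L₁ H₁ L₂ H₂ [ 0 ]

  ascending : Ascending 0 N (0 ∷ L₂ ++ L₁ ++ x ∷ H₁ ++ H₂)
  ascending =
    z≤n ≺∷ ascending-range-++ 1 (suc m) ≤-refl (ascending-range-++ (2 + m) m ≤-refl (≤-refl ≺∷
    ascending-range-++ (2 + m + m + 2) m H₁-start
    (ascending-range (1 + suc m + (3 + m + m)) (suc m) H₂-start H₂-end)))
    where
    H₁-start : suc (2 + m + m) ≤ 2 + m + m + 2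
    H₁-start = m+o≡n⇒m≤n 1 (solve (m ∷ []))
    H₂-start : 2 + m + m + 2 + m ≤ 1 + suc m + (3 + m + m)
    H₂-start = m+o≡n⇒m≤n 1 (solve (m ∷ []))
    H₂-end : 1 + suc m + (3 + m + m) + suc m ≤ suc (2 * (4 + m * 4))
    H₂-end = m+o≡n⇒m≤n (3 + m * 4) (solve (m ∷ []))

walk-4m+5 : ∀ m → Cyclic.ClosedWalk (5 + m * 4)
walk-4m+5 m = record
  { final             = z
  ; visited           = _
  ; walk              = reshape lengths visited
                          (up 0 x ▸ zigzag-walk (2 + m) 1 (suc m) ▸ up (2 + m) (5 + m * 4)
                           ▸ relocate (zigzag-walk (7 + m * 4) (4 + m + m) m) Z₂-start
                           ▸ up (7 + m * 4) (4 + m * 4))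
  ; closes            = trans (cong (_% N) z≡N) (n%n≡0 N)
  ; residues-distinct = ascending-residues-unique N ascending ≤-refl
  }
  where
  N  = suc (2 * (5 + m * 4))
  x  = 2 + m + suc m
  u  = 2 + m + (5 + m * 4)
  z  = 7 + m * 4 + (4 + m * 4)
  R₁ = range 1 (suc m + suc m)
  R₂ = range (4 + m + m) (m + m)
  L₁ = range (2 + m) (suc m)
  H₁ = range (2 + m + suc m + 1) (suc m)
  L₂ = range (7 + m * 4) m
  H₂ = range (7 + m * 4 + m + (4 + m + m)) m

  Z₂-start : 7 + m * 4 + m ≡ 2 + m + (5 + m * 4)
  Z₂-start = solve (m ∷ [])
  z≡N : 7 + m * 4 + (4 + m * 4) ≡ suc (2 * (5 + m * 4))
  z≡N = solve (m ∷ [])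

  lengths : x ∷ R₁ ++ (5 + m * 4) ∷ R₂ ++ [ 4 + m * 4 ] ↭ range 1 (5 + m * 4)
  lengths = ↭-consecutive⇒↭range 1 (5 + m * 4)
    (++-↭.solve 5 (λ x R₁ K R₂ c → x ⊕ (R₁ ⊕ (K ⊕ (R₂ ⊕ c))) ⊜ R₁ ⊕ (x ⊕ (R₂ ⊕ (c ⊕ K))))
       ↭-refl [ x ] R₁ [ 5 + m * 4 ] R₂ [ 4 + m * 4 ])
    (consecutive-range-++ 1 (suc m + suc m) refl (refl ≺∷
     consecutive-range-++ (4 + m + m) (m + m) R₂-start (R₂-end ≺∷ refl ≺∷ end refl)))
    where
    R₂-start : suc (2 + m + suc m) ≡ 4 + m + m
    R₂-start = solve (m ∷ [])
    R₂-end : 4 + m + m + (m + m) ≡ 4 + m * 4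
    R₂-end = solve (m ∷ [])

  visited : x ∷ (L₁ ++ H₁) ++ u ∷ (L₂ ++ H₂) ++ [ z ] ↭ L₁ ++ x ∷ H₁ ++ L₂ ++ u ∷ H₂ ++ [ z ]
  visited = ++-↭.solve 7 (λ x L₁ H₁ u L₂ H₂ n → x ⊕ ((L₁ ⊕ H₁) ⊕ (u ⊕ ((L₂ ⊕ H₂) ⊕ n)))
                                              ⊜ L₁ ⊕ (x ⊕ (H₁ ⊕ (L₂ ⊕ (u ⊕ (H₂ ⊕ n))))))
              ↭-refl [ x ] L₁ H₁ [ u ] L₂ H₂ [ z ]

  ascending : Ascending 1 (1 + N) (L₁ ++ x ∷ H₁ ++ L₂ ++ u ∷ H₂ ++ [ z ])
  ascending =
    ascending-range-++ (2 + m) (suc m) (s≤s z≤n) (≤-refl ≺∷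
    ascending-range-++ (2 + m + suc m + 1) (suc m) H₁-start
    (ascending-range-++ (7 + m * 4) m L₂-start (≤-reflexive Z₂-start ≺∷
    ascending-range-++ (7 + m * 4 + m + (4 + m + m)) m H₂-start
    (≤-reflexive z-start ≺∷ end (s≤s (≤-reflexive z≡N))))))
    where
    H₁-start : suc (2 + m + suc m) ≤ 2 + m + suc m + 1
    H₁-start = m+o≡n⇒m≤n 0 (solve (m ∷ []))
    L₂-start : 2 + m + suc m + 1 + suc m ≤ 7 + m * 4
    L₂-start = m+o≡n⇒m≤n (2 + m) (solve (m ∷ []))
    H₂-start : suc (2 + m + (5 + m * 4)) ≤ 7 + m * 4 + m + (4 + m + m)
    H₂-start = m+o≡n⇒m≤n (3 + m + m) (solve (m ∷ []))
    z-start : 7 + m * 4 + m + (4 + m + m) + m ≡ 7 + m * 4 + (4 + m * 4)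
    z-start = solve (m ∷ [])

walk-4m+6 : ∀ m → Cyclic.ClosedWalk (6 + m * 4)
walk-4m+6 m = record
  { final             = z
  ; visited           = _
  ; walk              = reshape lengths visited
                          (up 0 x ▸ zigzag-walk (3 + m) 2 (suc m) ▸ down (2 + m) 1 ▸ up (2 + m) (6 + m * 4)
                           ▸ relocate (zigzag-walk (8 + m * 4) (5 + m + m) m) Z₂-start
                           ▸ up (8 + m * 4) (5 + m * 4))
  ; closes            = trans (cong (_% N) z≡N) (n%n≡0 N)
  ; residues-distinct = ascending-residues-unique N ascending ≤-refl
  }
  where
  N  = suc (2 * (6 + m * 4))
  x  = 3 + m + suc m
  u  = 2 + m + (6 + m * 4)
  z  = 8 + m * 4 + (5 + m * 4)
  R₁ = range 2 (suc m + suc m)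
  R₂ = range (5 + m + m) (m + m)
  L₁ = range (3 + m) (suc m)
  H₁ = range (3 + m + suc m + 2) (suc m)
  L₂ = range (8 + m * 4) m
  H₂ = range (8 + m * 4 + m + (5 + m + m)) m

  Z₂-start : 8 + m * 4 + m ≡ 2 + m + (6 + m * 4)
  Z₂-start = solve (m ∷ [])
  z≡N : 8 + m * 4 + (5 + m * 4) ≡ suc (2 * (6 + m * 4))
  z≡N = solve (m ∷ [])

  lengths : x ∷ R₁ ++ 1 ∷ (6 + m * 4) ∷ R₂ ++ [ 5 + m * 4 ] ↭ range 1 (6 + m * 4)
  lengths = ↭-consecutive⇒↭range 1 (6 + m * 4)
    (++-↭.solve 6 (λ x R₁ o K R₂ c → x ⊕ (R₁ ⊕ (o ⊕ (K ⊕ (R₂ ⊕ c)))) ⊜ o ⊕ (R₁ ⊕ (x ⊕ (R₂ ⊕ (c ⊕ K)))))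
       ↭-refl [ x ] R₁ [ 1 ] [ 6 + m * 4 ] R₂ [ 5 + m * 4 ])
    (refl ≺∷ consecutive-range-++ 2 (suc m + suc m) refl (refl ≺∷
     consecutive-range-++ (5 + m + m) (m + m) R₂-start (R₂-end ≺∷ refl ≺∷ end refl)))
    where
    R₂-start : suc (3 + m + suc m) ≡ 5 + m + m
    R₂-start = solve (m ∷ [])
    R₂-end : 5 + m + m + (m + m) ≡ 5 + m * 4
    R₂-end = solve (m ∷ [])

  visited : x ∷ (L₁ ++ H₁) ++ (2 + m) ∷ u ∷ (L₂ ++ H₂) ++ [ z ]
          ↭ (2 + m) ∷ L₁ ++ x ∷ H₁ ++ L₂ ++ u ∷ H₂ ++ [ z ]
  visited = ++-↭.solve 8 (λ x L₁ H₁ w u L₂ H₂ n → x ⊕ ((L₁ ⊕ H₁) ⊕ (w ⊕ (u ⊕ ((L₂ ⊕ H₂) ⊕ n))))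
                                               ⊜ w ⊕ (L₁ ⊕ (x ⊕ (H₁ ⊕ (L₂ ⊕ (u ⊕ (H₂ ⊕ n)))))))
              ↭-refl [ x ] L₁ H₁ [ 2 + m ] [ u ] L₂ H₂ [ z ]

  ascending : Ascending 1 (1 + N) ((2 + m) ∷ L₁ ++ x ∷ H₁ ++ L₂ ++ u ∷ H₂ ++ [ z ])
  ascending =
    s≤s z≤n ≺∷ ascending-range-++ (3 + m) (suc m) ≤-refl (≤-refl ≺∷
    ascending-range-++ (3 + m + suc m + 2) (suc m) H₁-start
    (ascending-range-++ (8 + m * 4) m L₂-start (≤-reflexive Z₂-start ≺∷
    ascending-range-++ (8 + m * 4 + m + (5 + m + m)) m H₂-start
    (≤-reflexive z-start ≺∷ end (s≤s (≤-reflexive z≡N))))))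
    where
    H₁-start : suc (3 + m + suc m) ≤ 3 + m + suc m + 2
    H₁-start = m+o≡n⇒m≤n 1 (solve (m ∷ []))
    L₂-start : 3 + m + suc m + 2 + suc m ≤ 8 + m * 4
    L₂-start = m+o≡n⇒m≤n (suc m) (solve (m ∷ []))
    H₂-start : suc (2 + m + (6 + m * 4)) ≤ 8 + m * 4 + m + (5 + m + m)
    H₂-start = m+o≡n⇒m≤n (4 + m + m) (solve (m ∷ []))
    z-start : 8 + m * 4 + m + (5 + m + m) + m ≡ 8 + m * 4 + (5 + m * 4)
    z-start = solve (m ∷ [])

data Mod4 : ℕ → Set where
  0+4m : ∀ m → Mod4 (m * 4)
  1+4m : ∀ m → Mod4 (1 + m * 4)
  2+4m : ∀ m → Mod4 (2 + m * 4)
  3+4m : ∀ m → Mod4 (3 + m * 4)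

mod4 : ∀ n → Mod4 n
mod4 0 = 0+4m 0
mod4 1 = 1+4m 0
mod4 2 = 2+4m 0
mod4 3 = 3+4m 0
mod4 (suc (suc (suc (suc n)))) with mod4 n
... | 0+4m m = 0+4m (suc m)
... | 1+4m m = 1+4m (suc m)
... | 2+4m m = 2+4m (suc m)
... | 3+4m m = 3+4m (suc m)

closedWalk : ∀ n → Cyclic.ClosedWalk (3 + n)
closedWalk n with mod4 n
... | 0+4m m = walk-4m+3 m
... | 1+4m m = walk-4m+4 m
... | 2+4m m = walk-4m+5 m
... | 3+4m m = walk-4m+6 m

proposition2p1 : (k : ℕ) → 3 ≤ k →
    Σ (List (Zodd k)) (λ V → IsHalfSet k V × IsZeroSum k V
    × Σ (List (Zodd k)) (λ bs → IsSimpleOrderingOf k V bs))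
proposition2p1 (suc (suc (suc n))) (s≤s (s≤s (s≤s _))) = Cyclic.halfSet-of-walk (3 + n) (closedWalk n)
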